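{- Consider the following eight two-vertex Boolean networks $(f_1,f_2)$: $[1,01,11]$: $f_1=x_1\land x_2,f_2=\neg x_1\lor x_2$; $[2,01,11]$: $f_1=x_1\land x_2,f_2=1$; $[3,01,11]$: $f_1=x_1,f_2=1$; $[5,01,11]$: $f_1=x_1\leftrightarrow x_2,f_2=x_1\lor x_2$; $[6,01,11]$: $f_1=x_1\lor\neg x_2,f_2=x_1\lor x_2$; $[7,01,11]$: $f_1=x_1\leftrightarrow x_2,f_2=\neg x_1\lor x_2$; $[8,01,11]$: $f_1=x_1\leftrightarrow x_2,f_2=1$; $[9,01,11]$: $f_1=x_1\lor\neg x_2,f_2=1$. For any delay vector $(\alpha,\beta)$, every MBN built on one of these networks has exactly two attractors, the fixed points $(0,\beta)$ and $(\alpha,\beta)$.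
   Context: The MBN built on a two-vertex Boolean network $(f_1,f_2)$ with delay vector $(\alpha,\beta)$ of positive integers has configurations $(\rho,\gamma)$ with $0\le\rho\le\alpha$, $0\le\gamma\le\beta$, underlying Boolean state $x=([\rho\ge1],[\gamma\ge1])$, and dynamics: the first coordinate becomes $\alpha$ if $f_1(x)=1$, else $\max(\rho-1,0)$; the second becomes $\beta$ if $f_2(x)=1$, else $\max(\gamma-1,0)$. Attractors are periodic orbits: fixed points (length 1) and limit cycles (length $\ge2$). $x_1\leftrightarrow x_2$ denotes equivalence (value 1 iff $x_1=x_2$). -}

module Defs where

open import Data.Bool using (Bool; true; false; not; _∧_; _∨_; _xor_; if_then_else_)
open import Data.Nat using (ℕ; zero; suc; _≤_; _≤ᵇ_; pred)
open import Data.Product using (_×_; _,_; ∃)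
open import Relation.Binary.PropositionalEquality using (_≡_)

BN : Set
BN = (Bool → Bool → Bool) × (Bool → Bool → Bool)

_⟷_ : Bool → Bool → Bool
a ⟷ b = not (a xor b)

data Net : Set where
  n1 n2 n3 n5 n6 n7 n8 n9 : Net

network : Net → BN
network n1 = (λ x₁ x₂ → x₁ ∧ x₂)      , (λ x₁ x₂ → not x₁ ∨ x₂)
network n2 = (λ x₁ x₂ → x₁ ∧ x₂)      , (λ x₁ x₂ → true)
network n3 = (λ x₁ x₂ → x₁)           , (λ x₁ x₂ → true)
network n5 = (λ x₁ x₂ → x₁ ⟷ x₂)      , (λ x₁ x₂ → x₁ ∨ x₂)
network n6 = (λ x₁ x₂ → x₁ ∨ not x₂)  , (λ x₁ x₂ → x₁ ∨ x₂)
network n7 = (λ x₁ x₂ → x₁ ⟷ x₂)      , (λ x₁ x₂ → not x₁ ∨ x₂)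
network n8 = (λ x₁ x₂ → x₁ ⟷ x₂)      , (λ x₁ x₂ → true)
network n9 = (λ x₁ x₂ → x₁ ∨ not x₂)  , (λ x₁ x₂ → true)

Config : Set
Config = ℕ × ℕ

IsConfig : ℕ → ℕ → Config → Set
IsConfig α β (ρ , γ) = ρ ≤ α × γ ≤ β

mbnStep : BN → ℕ → ℕ → Config → Config
mbnStep (f₁ , f₂) α β (ρ , γ) =
  let x₁ = 1 ≤ᵇ ρ
      x₂ = 1 ≤ᵇ γ
  in (if f₁ x₁ x₂ then α else pred ρ) , (if f₂ x₁ x₂ then β else pred γ)

iter : {A : Set} → (A → A) → ℕ → A → A
iter F zero    c = c
iter F (suc k) c = F (iter F k c)

-- c lies on a periodic orbit (i.e. on an attractor).
IsPeriodic : (Config → Config) → Config → Set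
IsPeriodic F c = ∃ λ k → iter F (suc k) c ≡ c

IsFixedPoint : (Config → Config) → Config → Set
IsFixedPoint F c = F c ≡ c

{-# OPTIONS --safe #-}
-- All eight networks fix the states 01 and 11, so from x₂ = 1 one step lands on
-- (0 , β) or (α , β), both fixed points of the MBN. From x₂ = 0 each network
-- switches x₂ on after finitely many steps (for [1] and [7] by counting ρ down).
-- Hence every configuration reaches one of the two fixed points, and a periodic
-- configuration that reaches a fixed point must be that fixed point.
module Submission where

open import Defs
open import Data.Bool using (true; false)
open import Data.Nat using (ℕ; _≤_; zero; suc; _+_; _*_; s≤s; z≤n)
open import Data.Nat.Properties using (+-comm; *-suc)
open import Data.Product using (_×_; _,_; ∃; proj₁; proj₂)
open import Data.Sum using (_⊎_; inj₁; inj₂)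
open import Function.Bundles using (_⇔_; mk⇔)
open import Relation.Binary.PropositionalEquality
  using (_≡_; refl; sym; trans; cong; subst; module ≡-Reasoning)

module _ {A : Set} (F : A → A) where

  iter-+ : ∀ m n x → iter F (m + n) x ≡ iter F m (iter F n x)
  iter-+ zero    n x = refl
  iter-+ (suc m) n x = cong F (iter-+ m n x)

  iter-sucʳ : ∀ n x → iter F (suc n) x ≡ iter F n (F x)
  iter-sucʳ zero    x = refl
  iter-sucʳ (suc n) x = cong F (iter-sucʳ n x)

  iter-fixed : ∀ {p} → F p ≡ p → ∀ n → iter F n p ≡ p
  iter-fixed Fp≡p zero    = refl
  iter-fixed Fp≡p (suc n) = trans (cong F (iter-fixed Fp≡p n)) Fp≡p

  iter-period-* : ∀ {x} k → iter F (suc k) x ≡ x → ∀ m → iter F (m * suc k) x ≡ x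
  iter-period-* k per zero    = refl
  iter-period-* {x} k per (suc m) = begin
    iter F (suc k + m * suc k) x          ≡⟨ iter-+ (suc k) (m * suc k) x ⟩
    iter F (suc k) (iter F (m * suc k) x) ≡⟨ cong (iter F (suc k)) (iter-period-* k per m) ⟩
    iter F (suc k) x                      ≡⟨ per ⟩
    x                                     ∎
    where open ≡-Reasoning

  periodic-reaching-fixed : ∀ {x p} → F p ≡ p → ∀ t → iter F t x ≡ p →
    ∀ k → iter F (suc k) x ≡ x → x ≡ p
  periodic-reaching-fixed {x} {p} Fp≡p t reach k per = begin
    x                             ≡⟨ sym (iter-period-* k per t) ⟩
    iter F (t * suc k) x          ≡⟨ cong (λ s → iter F s x) t*[1+k]≡t*k+t ⟩
    iter F (t * k + t) x          ≡⟨ iter-+ (t * k) t x ⟩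
    iter F (t * k) (iter F t x)   ≡⟨ cong (iter F (t * k)) reach ⟩
    iter F (t * k) p              ≡⟨ iter-fixed Fp≡p (t * k) ⟩
    p                             ∎
    where
    open ≡-Reasoning
    t*[1+k]≡t*k+t : t * suc k ≡ t * k + t
    t*[1+k]≡t*k+t = trans (*-suc t k) (+-comm t (t * k))

  Reaches : (A → Set) → A → Set
  Reaches P x = ∃ λ t → P (iter F t x)

  reaches-step : ∀ {P x} → Reaches P (F x) → Reaches P x
  reaches-step {P} {x} (t , Pt) = suc t , subst P (sym (iter-sucʳ t x)) Pt

  reaches-trans : ∀ {P Q x} → Reaches P x → (∀ {y} → P y → Reaches Q y) → Reaches Q x
  reaches-trans {Q = Q} {x} (t , Pt) P⇒Q with P⇒Q Pt
  ... | u , Qu = u + t , subst Q (sym (iter-+ u t x)) Qu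

  periodic-reaching-fixed-set : ∀ {P x} → (∀ {y} → P y → F y ≡ y) → Reaches P x →
    ∀ k → iter F (suc k) x ≡ x → P x
  periodic-reaching-fixed-set {P} fixed (t , Pt) k per =
    subst P (sym (periodic-reaching-fixed (fixed Pt) t refl k per)) Pt

record Fixes01and11 (f : BN) : Set where
  constructor fixes01and11
  field
    f₁-01 : proj₁ f false true ≡ false
    f₂-01 : proj₂ f false true ≡ true
    f₁-11 : proj₁ f true true ≡ true
    f₂-11 : proj₂ f true true ≡ true

network-fixes01and11 : ∀ n → Fixes01and11 (network n)
network-fixes01and11 n1 = fixes01and11 refl refl refl refl
network-fixes01and11 n2 = fixes01and11 refl refl refl refl
network-fixes01and11 n3 = fixes01and11 refl refl refl refl
network-fixes01and11 n5 = fixes01and11 refl refl refl refl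
network-fixes01and11 n6 = fixes01and11 refl refl refl refl
network-fixes01and11 n7 = fixes01and11 refl refl refl refl
network-fixes01and11 n8 = fixes01and11 refl refl refl refl
network-fixes01and11 n9 = fixes01and11 refl refl refl refl

X₂Saturated : ℕ → Config → Set
X₂Saturated β c = proj₂ c ≡ β

Attractor : ℕ → ℕ → Config → Set
Attractor α β c = c ≡ (0 , β) ⊎ c ≡ (α , β)

module _ {f : BN} (fixes : Fixes01and11 f) (a b : ℕ) where

  open Fixes01and11 fixes

  mbnStep-fixed-0β : mbnStep f (suc a) (suc b) (0 , suc b) ≡ (0 , suc b)
  mbnStep-fixed-0β rewrite f₁-01 | f₂-01 = refl

  mbnStep-fixed-αβ : mbnStep f (suc a) (suc b) (suc a , suc b) ≡ (suc a , suc b)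
  mbnStep-fixed-αβ rewrite f₁-11 | f₂-11 = refl

  mbnStep-fixed-attractor : ∀ {c} → Attractor (suc a) (suc b) c →
    mbnStep f (suc a) (suc b) c ≡ c
  mbnStep-fixed-attractor (inj₁ refl) = mbnStep-fixed-0β
  mbnStep-fixed-attractor (inj₂ refl) = mbnStep-fixed-αβ

  mbnStep-from-x₂-on : ∀ ρ g →
    Attractor (suc a) (suc b) (mbnStep f (suc a) (suc b) (ρ , suc g))
  mbnStep-from-x₂-on zero g rewrite f₁-01 | f₂-01 = inj₁ refl
  mbnStep-from-x₂-on (suc r) g rewrite f₁-11 | f₂-11 = inj₂ refl

  reaches-attractor-from-x₂-on : ∀ {c} → X₂Saturated (suc b) c →
    Reaches (mbnStep f (suc a) (suc b)) (Attractor (suc a) (suc b)) c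
  reaches-attractor-from-x₂-on {ρ , γ} refl = 1 , mbnStep-from-x₂-on ρ b

x₂-switches-on : ∀ n a b ρ →
  Reaches (mbnStep (network n) (suc a) (suc b)) (X₂Saturated (suc b)) (ρ , 0)
x₂-switches-on n1 a b zero    = 1 , refl
x₂-switches-on n1 a b (suc r) = reaches-step _ {X₂Saturated (suc b)} (x₂-switches-on n1 a b r)
x₂-switches-on n2 a b ρ       = 1 , refl
x₂-switches-on n3 a b ρ       = 1 , refl
x₂-switches-on n5 a b zero    = 2 , refl
x₂-switches-on n5 a b (suc r) = 1 , refl
x₂-switches-on n6 a b zero    = 2 , refl
x₂-switches-on n6 a b (suc r) = 1 , refl
x₂-switches-on n7 a b zero    = 1 , refl
x₂-switches-on n7 a b (suc r) = reaches-step _ {X₂Saturated (suc b)} (x₂-switches-on n7 a b r)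
x₂-switches-on n8 a b ρ       = 1 , refl
x₂-switches-on n9 a b ρ       = 1 , refl

reaches-attractor : ∀ n a b c →
  Reaches (mbnStep (network n) (suc a) (suc b)) (Attractor (suc a) (suc b)) c
reaches-attractor n a b (ρ , zero) =
  reaches-trans _ {X₂Saturated (suc b)} {Attractor (suc a) (suc b)}
    (x₂-switches-on n a b ρ) (reaches-attractor-from-x₂-on (network-fixes01and11 n) a b)
reaches-attractor n a b (ρ , suc g) =
  1 , mbnStep-from-x₂-on (network-fixes01and11 n) a b ρ g

proposition16 : (n : Net) (α β : ℕ) → 1 ≤ α → 1 ≤ β →
    ((c : Config) → IsConfig α β c →
    (IsPeriodic (mbnStep (network n) α β) c ⇔ (c ≡ (0 , β) ⊎ c ≡ (α , β))))
    × IsFixedPoint (mbnStep (network n) α β) (0 , β)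
    × IsFixedPoint (mbnStep (network n) α β) (α , β)
proposition16 n (suc a) (suc b) (s≤s z≤n) (s≤s z≤n) =
  (λ c _ → mk⇔ (periodic⇒attractor c) attractor⇒periodic) ,
  mbnStep-fixed-0β fixes a b , mbnStep-fixed-αβ fixes a b
  where
  fixes : Fixes01and11 (network n)
  fixes = network-fixes01and11 n

  F : Config → Config
  F = mbnStep (network n) (suc a) (suc b)

  periodic⇒attractor : ∀ c → IsPeriodic F c → Attractor (suc a) (suc b) c
  periodic⇒attractor c (k , per) =
    periodic-reaching-fixed-set F (mbnStep-fixed-attractor fixes a b)
      (reaches-attractor n a b c) k per

  attractor⇒periodic : ∀ {c} → Attractor (suc a) (suc b) c → IsPeriodic F c
  attractor⇒periodic att = 0 , mbnStep-fixed-attractor fixes a b att
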